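{- (1) If $\ell$ is a prime with $\ell\equiv 1\pmod{12}$, then the equation $X^2+Y^2+Z^2=3\ell^2$ has no solutions $X,Y,Z\in\mathbb{Z}$ with $X\equiv Y\equiv Z\equiv 5\pmod{12}$. (2) If $\ell$ is a prime with $\ell\equiv 7\pmod{12}$, then the equation $X^2+Y^2+Z^2=3\ell^2$ has no solutions $X,Y,Z\in\mathbb{Z}$ with $X\equiv Y\equiv Z\equiv 1\pmod{12}$. -}

module Defs where

open import Data.Nat using (ℕ)
open import Data.Integer using (ℤ; +_; _-_)
open import Data.Integer.Divisibility using (_∣_)

_≡_[modℤ_] : ℤ → ℤ → ℕ → Set
a ≡ b [modℤ m ] = (+ m) ∣ (a - b)

{-# OPTIONS --safe #-}
module Submission where

-- Write ℓ = c + 12L with c = 1 + 6j and X, Y, Z = c + 4 + 12x, c + 4 + 12y, c + 4 + 12z (in case (2)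
-- after negating X, Y, Z).  The equation then says t w = 8 Q(α, β) and t + w = ℓ, where α = x − y,
-- β = y − z and Q(a, b) = a² + ab + b² is the norm form of ℤ[ω].  Modulo 3 this forces t ≡ 1, and as
-- Q ≥ 0 and ℓ > 0 both t and w are positive, w being odd.  So Q(4α, 4β) = 2t · w with 2t ≡ 2 (mod 3)
-- and 2t coprime to w, since t + w = ℓ is prime.  Now 2t has a prime factor q ≡ 2 (mod 3), and such
-- primes are inert in ℤ[ω]: q ∣ Q(a, b) forces q ∣ a, b (Euler's descent on a small multiple k q
-- represented by Q).  Hence q² can be cancelled from both sides, and iterating is an infinite descent.

open import Defs
open import Data.Nat using (ℕ)
open import Data.Nat.Primality using (Prime)
open import Data.Integer using (ℤ; +_; _+_; _*_)
open import Data.Product using (_×_)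
open import Relation.Binary.PropositionalEquality using (_≡_)
open import Relation.Nullary using (¬_)

open import Data.Empty using (⊥; ⊥-elim)
open import Data.Integer using (-[1+_]; +[1+_]; -_; _-_; ∣_∣; 0ℤ; _≤_; +≤+)
import Data.Integer.DivMod as ℤ
open import Data.Integer.Divisibility.Signed as ℤ∣ using (divides)
  renaming (_∣_ to _∣ℤ_; _∣?_ to _∣ℤ?_)
import Data.Integer.Properties as ℤ
open import Data.Integer.Tactic.RingSolver using (solve-∀)
open import Data.List.Base using ([]; _∷_)
open import Data.List.Relation.Unary.All using (All; []; _∷_)
open import Data.Nat as ℕ using (zero; suc; _<_; z≤n; s≤s; _%_; _/_; _⊔_; NonZero)
open import Data.Nat.Coprimality as Coprime using (Coprime; coprime-divisor; prime⇒coprime)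
open import Data.Nat.Divisibility
  using (_∣_; divides; ∣-refl; ∣-trans; ∣⇒≤; ∣1⇒≡1; m∣m*n; n∣m*n; ∣n⇒∣m*n; ∣m+n∣m⇒∣n;
         ∣m∣n⇒∣m+n; m%n≡0⇒n∣m; n∣m⇒m%n≡0)
open import Data.Nat.DivMod
  using (m%n<n; [m+kn]%n≡m%n; %-distribˡ-*; %-remove-+ˡ; m%n%n≡m%n; m/n<m; m/n≤m; m/n*n≡m; m≥n⇒m/n>0; m*[n/m]≡n)
open import Data.Nat.Induction using (<-rec)
open import Data.Nat.ListAction using (product)
open import Data.Nat.Primality
  using (prime?; prime[2]; euclidsLemma; prime⇒irreducible; prime⇒nonZero; prime⇒nonTrivial)
open import Data.Nat.Primality.Factorisation using (factorise)
import Data.Nat.Properties as ℕ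
import Data.Nat.Tactic.RingSolver as ℕ-Solver
open import Data.Product using (∃; ∃₂; _,_)
open import Data.Sum using (_⊎_; inj₁; inj₂; [_,_]′)
open import Data.Unit using (tt)
open import Function using (id)
open import Relation.Binary.PropositionalEquality using (_≢_; refl; sym; trans; cong; cong₂; subst; module ≡-Reasoning)
open import Relation.Nullary using (yes; no; contradiction)
open import Relation.Nullary.Decidable using (toWitness)

open ≡-Reasoning

%3-cases : ∀ n → n % 3 ≡ 0 ⊎ n % 3 ≡ 1 ⊎ n % 3 ≡ 2
%3-cases n with n % 3 | m%n<n n 3
... | 0 | _ = inj₁ refl
... | 1 | _ = inj₂ (inj₁ refl)
... | 2 | _ = inj₂ (inj₂ refl)
... | suc (suc (suc _)) | s≤s (s≤s (s≤s ()))

%-*-≡ : ∀ m n d {r s} .{{_ : NonZero d}} → m % d ≡ r → n % d ≡ s → (m ℕ.* n) % d ≡ (r ℕ.* s) % d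
%-*-≡ m n d refl refl = %-distribˡ-* m n d

square%3≢2 : ∀ d → (d ℕ.* d) % 3 ≢ 2
square%3≢2 d rewrite %-distribˡ-* d d 3 {{_}} with d % 3 | m%n<n d 3
... | 0 | _ = λ ()
... | 1 | _ = λ ()
... | 2 | _ = λ ()
... | suc (suc (suc _)) | s≤s (s≤s (s≤s ()))

*-%3≡2 : ∀ m n → (m ℕ.* n) % 3 ≡ 2 → m % 3 ≡ 2 ⊎ n % 3 ≡ 2
*-%3≡2 m n rewrite %-distribˡ-* m n 3 {{_}} with m % 3 | m%n<n m 3 | n % 3 | m%n<n n 3
... | 2 | _ | _ | _ = λ _ → inj₁ refl
... | _ | _ | 2 | _ = λ _ → inj₂ refl
... | 0 | _ | 0 | _ = λ ()
... | 0 | _ | 1 | _ = λ ()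
... | 1 | _ | 0 | _ = λ ()
... | 1 | _ | 1 | _ = λ ()
... | suc (suc (suc _)) | s≤s (s≤s (s≤s ())) | _ | _
... | _ | _ | suc (suc (suc _)) | s≤s (s≤s (s≤s ()))

%3-*-square : ∀ m q → q % 3 ≡ 2 → (m ℕ.* (q ℕ.* q)) % 3 ≡ m % 3
%3-*-square m q q≡2 = begin
  (m ℕ.* (q ℕ.* q)) % 3  ≡⟨ %-*-≡ m (q ℕ.* q) 3 refl (%-*-≡ q q 3 q≡2 q≡2) ⟩
  (m % 3 ℕ.* 1) % 3      ≡⟨ cong (_% 3) (ℕ.*-identityʳ (m % 3)) ⟩
  m % 3 % 3              ≡⟨ m%n%n≡m%n m 3 ⟩
  m % 3                  ∎

%3≡2⇒nonZero : ∀ {n} → n % 3 ≡ 2 → NonZero n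
%3≡2⇒nonZero {zero} ()
%3≡2⇒nonZero {suc _} _ = _

prime[3] : Prime 3
prime[3] = toWitness {a? = prime? 3} tt

3∣square⇒3∣ : ∀ d → 3 ∣ d ℕ.* d → 3 ∣ d
3∣square⇒3∣ d 3∣d² = [ id , id ]′ (euclidsLemma d d prime[3] 3∣d²)

product%3≡2 : ∀ {ns} → All Prime ns → product ns % 3 ≡ 2 → ∃ λ q → Prime q × q % 3 ≡ 2 × q ∣ product ns
product%3≡2 {[]} [] ()
product%3≡2 {n ∷ ns} (n-prime ∷ ns-prime) Π≡2 with *-%3≡2 n (product ns) Π≡2
... | inj₁ n≡2 = n , n-prime , n≡2 , m∣m*n (product ns)
... | inj₂ Π′≡2 with q , q-prime , q≡2 , q∣Π′ ← product%3≡2 ns-prime Π′≡2 =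
  q , q-prime , q≡2 , ∣n⇒∣m*n n q∣Π′

prime-factor%3≡2 : ∀ m → m % 3 ≡ 2 → ∃ λ q → Prime q × q % 3 ≡ 2 × q ∣ m
prime-factor%3≡2 m@(suc _) m≡2
  with record { isFactorisation = m≡Π ; factorsPrime = Π-prime } ← factorise m
  with q , q-prime , q≡2 , q∣Π ← product%3≡2 Π-prime (subst (λ n → n % 3 ≡ 2) m≡Π m≡2)
  = q , q-prime , q≡2 , subst (q ∣_) (sym m≡Π) q∣Π

coprime-* : ∀ {m n c} → Coprime m c → Coprime n c → Coprime (m ℕ.* n) c
coprime-* m⊥c n⊥c (d∣mn , d∣c) =
  n⊥c (coprime-divisor (λ (e∣d , e∣m) → m⊥c (e∣m , ∣-trans e∣d d∣c)) d∣mn , d∣c)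

prime∤⇒coprime : ∀ {p n} → Prime p → ¬ p ∣ n → Coprime p n
prime∤⇒coprime p-prime p∤n (d∣p , d∣n) with prime⇒irreducible p-prime d∣p
... | inj₁ d≡1 = d≡1
... | inj₂ refl = contradiction d∣n p∤n

0≤i*j : ∀ {i j} → 0ℤ ≤ i → 0ℤ ≤ j → 0ℤ ≤ i * j
0≤i*j (+≤+ {n = m} _) (+≤+ {n = n} _) = subst (0ℤ ≤_) (ℤ.pos-* m n) (+≤+ z≤n)

nonneg-summands : ∀ t w → 0ℤ ≤ t * w → 0ℤ ≤ t + w → 0ℤ ≤ t × 0ℤ ≤ w
nonneg-summands (+ _) (+ _) _ _ = +≤+ z≤n , +≤+ z≤n
nonneg-summands (+ zero) -[1+ _ ] _ ()
nonneg-summands +[1+ _ ] -[1+ _ ] () _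
nonneg-summands -[1+ _ ] (+ zero) _ ()
nonneg-summands -[1+ _ ] +[1+ _ ] () _
nonneg-summands -[1+ _ ] -[1+ _ ] _ ()

modℤ-witness : ∀ a b {m} → a ≡ b [modℤ m ] → ∃ λ k → a ≡ b + k * + m
modℤ-witness a b {m} a≡b with divides k a-b≡km ← ℤ∣.∣ᵤ⇒∣ {i = a - b} a≡b = k , (begin
  a              ≡⟨ identity a b ⟩
  b + (a - b)    ≡⟨ cong (_+_ b) a-b≡km ⟩
  b + k * + m    ∎)
  where
  identity : ∀ a b → a ≡ b + (a - b)
  identity = solve-∀

modℤ-neg : ∀ a b {m} → a ≡ b [modℤ m ] → (- a) ≡ (+ m - b) [modℤ m ]
modℤ-neg a b {m} a≡b =
  ℤ∣.∣⇒∣ᵤ (subst (+ m ∣ℤ_) (identity a b (+ m))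
    (ℤ∣.∣m∣n⇒∣m-n (ℤ∣.∣m⇒∣-m (ℤ∣.∣ᵤ⇒∣ {i = a - b} a≡b)) ℤ∣.∣-refl))
  where
  identity : ∀ a b m → - (a - b) - m ≡ - a - (m - b)
  identity = solve-∀

≡1[modℤ]⇒%≡1 : ∀ {m} n → (+ n) ≡ (+ 1) [modℤ suc (suc m) ] → n % suc (suc m) ≡ 1
≡1[modℤ]⇒%≡1 zero 2+m∣1 = contradiction (∣1⇒≡1 2+m∣1) λ ()
≡1[modℤ]⇒%≡1 {m} (suc n) (divides q refl) = [m+kn]%n≡m%n 1 q (suc (suc m))

Q : ℤ → ℤ → ℤ
Q a b = a * a + a * b + b * b

Qℕ : ℕ → ℕ → ℕ
Qℕ x y = x ℕ.* x ℕ.+ x ℕ.* y ℕ.+ y ℕ.* y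

-- The ring solver does not unfold Q, so identities are proved in expanded form.
Q-comm : ∀ a b → Q a b ≡ Q b a
Q-comm = identity
  where
  identity : ∀ a b → a * a + a * b + b * b ≡ b * b + b * a + a * a
  identity = solve-∀

Q-*ʳ : ∀ a b k → Q (a * k) (b * k) ≡ Q a b * (k * k)
Q-*ʳ = identity
  where
  identity : ∀ a b k → a * k * (a * k) + a * k * (b * k) + b * k * (b * k) ≡ (a * a + a * b + b * b) * (k * k)
  identity = solve-∀

Q-pos : ∀ x y → Q (+ x) (+ y) ≡ + Qℕ x y
Q-pos x y = sym (cong₂ _+_ (cong₂ _+_ (ℤ.pos-* x x) (ℤ.pos-* x y)) (ℤ.pos-* y y))

Q-nonneg : ∀ a b → 0ℤ ≤ Q a b
Q-nonneg a b = nonneg (begin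
  + 4 * Q a b                                      ≡⟨ four-Q a b ⟩
  c * c + + 3 * (b * b)                            ≡⟨ cong₂ _+_ (square c) (cong (+ 3 *_) (square b)) ⟩
  + (∣ c ∣ ℕ.* ∣ c ∣) + + 3 * + (∣ b ∣ ℕ.* ∣ b ∣)  ≡⟨ cong (_+_ (+ (∣ c ∣ ℕ.* ∣ c ∣))) (ℤ.pos-* 3 (∣ b ∣ ℕ.* ∣ b ∣)) ⟨
  + (∣ c ∣ ℕ.* ∣ c ∣ ℕ.+ 3 ℕ.* (∣ b ∣ ℕ.* ∣ b ∣))    ∎)
  where
  c : ℤ
  c = + 2 * a + b
  four-Q : ∀ a b → + 4 * (a * a + a * b + b * b) ≡ (+ 2 * a + b) * (+ 2 * a + b) + + 3 * (b * b)
  four-Q = solve-∀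
  square : ∀ i → i * i ≡ + (∣ i ∣ ℕ.* ∣ i ∣)
  square (+ n) = sym (ℤ.pos-* n n)
  square -[1+ n ] = refl
  nonneg : ∀ {i n} → + 4 * i ≡ + n → 0ℤ ≤ i
  nonneg {+ _} _ = +≤+ z≤n
  nonneg { -[1+ _ ]} ()

Q-cong : ∀ {k} a b a′ b′ → k ∣ℤ a - a′ → k ∣ℤ b - b′ → k ∣ℤ Q a b → k ∣ℤ Q a′ b′
Q-cong {k} a b a′ b′ k∣a-a′ k∣b-b′ k∣Q =
  subst (k ∣ℤ_) (identity a a′ b b′)
    (ℤ∣.∣m∣n⇒∣m-n k∣Q (ℤ∣.∣m∣n⇒∣m+n (ℤ∣.∣m⇒∣m*n (a + a′ + b) k∣a-a′)
                                    (ℤ∣.∣m⇒∣m*n (a′ + b + b′) k∣b-b′)))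
  where
  identity : ∀ a a′ b b′ →
    a * a + a * b + b * b - ((a - a′) * (a + a′ + b) + (b - b′) * (a′ + b + b′)) ≡ a′ * a′ + a′ * b′ + b′ * b′
  identity = solve-∀

Q-pos-neg : ∀ r s → ∃₂ λ x y → x ℕ.+ y ≡ r ⊔ s × Q (+ r) (- + s) ≡ + Qℕ x y
Q-pos-neg r s with ℕ.≤-total s r
... | inj₁ s≤r =
  r ℕ.∸ s , s , trans (ℕ.+-comm (r ℕ.∸ s) s) (trans (ℕ.m+[n∸m]≡n s≤r) (sym (ℕ.m≥n⇒m⊔n≡m s≤r))) ,
  (begin
    Q (+ r) (- + s)                   ≡⟨ cong (λ n → Q (+ n) (- + s)) (sym (ℕ.m+[n∸m]≡n s≤r)) ⟩
    Q (+ s + + (r ℕ.∸ s)) (- + s)     ≡⟨ identity (+ s) (+ (r ℕ.∸ s)) ⟩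
    Q (+ (r ℕ.∸ s)) (+ s)             ≡⟨ Q-pos (r ℕ.∸ s) s ⟩
    + Qℕ (r ℕ.∸ s) s                  ∎)
  where
  identity : ∀ s e → (s + e) * (s + e) + (s + e) * (- s) + (- s) * (- s) ≡ e * e + e * s + s * s
  identity = solve-∀
... | inj₂ r≤s =
  r , s ℕ.∸ r , trans (ℕ.m+[n∸m]≡n r≤s) (sym (ℕ.m≤n⇒m⊔n≡n r≤s)) ,
  (begin
    Q (+ r) (- + s)                   ≡⟨ cong (λ n → Q (+ r) (- + n)) (sym (ℕ.m+[n∸m]≡n r≤s)) ⟩
    Q (+ r) (- (+ r + + (s ℕ.∸ r)))   ≡⟨ identity (+ r) (+ (s ℕ.∸ r)) ⟩
    Q (+ r) (+ (s ℕ.∸ r))             ≡⟨ Q-pos r (s ℕ.∸ r) ⟩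
    + Qℕ r (s ℕ.∸ r)                  ∎)
  where
  identity : ∀ r e → r * r + r * (- (r + e)) + (- (r + e)) * (- (r + e)) ≡ r * r + r * e + e * e
  identity = solve-∀

Q-mod3 : ∀ a b → Q a b ≡ ((a - b) * (a - b)) [modℤ 3 ]
Q-mod3 a b = ℤ∣.∣⇒∣ᵤ (divides (a * b) (identity a b))
  where
  identity : ∀ a b → a * a + a * b + b * b - (a - b) * (a - b) ≡ a * b * + 3
  identity = solve-∀

Qℕ-comm : ∀ x y → Qℕ x y ≡ Qℕ y x
Qℕ-comm = identity
  where
  identity : ∀ x y → x ℕ.* x ℕ.+ x ℕ.* y ℕ.+ y ℕ.* y ≡ y ℕ.* y ℕ.+ y ℕ.* x ℕ.+ x ℕ.* x
  identity = ℕ-Solver.solve-∀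

Qℕ-pos : ∀ x y → 0 < x ℕ.+ y → 0 < Qℕ x y
Qℕ-pos (suc x) y _ = ℕ.z<s
Qℕ-pos zero (suc y) _ = ℕ.z<s

Qℕ≤square : ∀ x y → Qℕ x y ℕ.≤ (x ℕ.+ y) ℕ.* (x ℕ.+ y)
Qℕ≤square x y = subst (Qℕ x y ℕ.≤_) (sym (identity x y)) (ℕ.m≤m+n (Qℕ x y) (x ℕ.* y))
  where
  identity : ∀ x y → (x ℕ.+ y) ℕ.* (x ℕ.+ y) ≡ x ℕ.* x ℕ.+ x ℕ.* y ℕ.+ y ℕ.* y ℕ.+ x ℕ.* y
  identity = ℕ-Solver.solve-∀

Qℕ-sorted : ∀ x y → ∃₂ λ u d → Qℕ x y ≡ Qℕ (u ℕ.+ d) u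
Qℕ-sorted x y with ℕ.≤-total y x
... | inj₁ y≤x = y , x ℕ.∸ y , cong (λ x → Qℕ x y) (sym (ℕ.m+[n∸m]≡n y≤x))
... | inj₂ x≤y = x , y ℕ.∸ x , trans (Qℕ-comm x y) (cong (λ y → Qℕ y x) (sym (ℕ.m+[n∸m]≡n x≤y)))

Qℕ-shift : ∀ u d → Qℕ (u ℕ.+ d) u ≡ u ℕ.* (u ℕ.+ d) ℕ.* 3 ℕ.+ d ℕ.* d
Qℕ-shift = identity
  where
  identity : ∀ u d → (u ℕ.+ d) ℕ.* (u ℕ.+ d) ℕ.+ (u ℕ.+ d) ℕ.* u ℕ.+ u ℕ.* u
                     ≡ u ℕ.* (u ℕ.+ d) ℕ.* 3 ℕ.+ d ℕ.* d
  identity = ℕ-Solver.solve-∀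

Qℕ%3≢2 : ∀ x y → Qℕ x y % 3 ≢ 2
Qℕ%3≢2 x y Q≡2 with u , d , Q≡ ← Qℕ-sorted x y = square%3≢2 d (begin
  (d ℕ.* d) % 3                             ≡⟨ %-remove-+ˡ (d ℕ.* d) (n∣m*n (u ℕ.* (u ℕ.+ d))) ⟨
  (u ℕ.* (u ℕ.+ d) ℕ.* 3 ℕ.+ d ℕ.* d) % 3  ≡⟨ cong (_% 3) (trans Q≡ (Qℕ-shift u d)) ⟨
  Qℕ x y % 3                                ≡⟨ Q≡2 ⟩
  2                                         ∎)

Qℕ-multiple-of-3 : ∀ x y {n} → Qℕ x y ≡ 3 ℕ.* n → ∃₂ λ x′ y′ → Qℕ x′ y′ ≡ n
Qℕ-multiple-of-3 x y {n} Q≡3n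
  with u , d , Q≡ ← Qℕ-sorted x y
  with divides e refl ← 3∣square⇒3∣ d
         (∣m+n∣m⇒∣n (divides n (trans (sym (trans Q≡ (Qℕ-shift u d))) (trans Q≡3n (ℕ.*-comm 3 n))))
                    (n∣m*n (u ℕ.* (u ℕ.+ d))))
  = e ℕ.+ u , e , ℕ.*-cancelˡ-≡ _ _ 3 (trans (sym (descent u e)) (trans (sym Q≡) Q≡3n))
  where
  descent : ∀ u e → Qℕ (u ℕ.+ e ℕ.* 3) u ≡ 3 ℕ.* Qℕ (e ℕ.+ u) e
  descent = identity
    where
    identity : ∀ u e → (u ℕ.+ e ℕ.* 3) ℕ.* (u ℕ.+ e ℕ.* 3) ℕ.+ (u ℕ.+ e ℕ.* 3) ℕ.* u ℕ.+ u ℕ.* u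
                       ≡ 3 ℕ.* ((e ℕ.+ u) ℕ.* (e ℕ.+ u) ℕ.+ (e ℕ.+ u) ℕ.* e ℕ.+ e ℕ.* e)
    identity = ℕ-Solver.solve-∀

-- Primes ≡ 2 (mod 3) are inert

-- q stays prime in ℤ[ω], Q a b being the norm of a − b ω.
Inert : ℕ → Set
Inert q = ∀ a b → + q ∣ℤ Q a b → + q ∣ℤ a

InertBelow : ℕ → Set
InertBelow n = ∀ {q} → q < n → Prime q → q % 3 ≡ 2 → Inert q

Q-divide-out : ∀ {q m c} → Prime q → Inert q → q ∣ m → Coprime m c → ∀ a b → Q a b ≡ + (m ℕ.* c) →
               ∃₂ λ m′ a′ → ∃ λ b′ → m ≡ m′ ℕ.* (q ℕ.* q) × Q a′ b′ ≡ + (m′ ℕ.* c)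
Q-divide-out {q} {m} {c} q-prime q-inert q∣m m⊥c a b Q≡mc =
  m′ , a′ , b′ , m≡m′qq , trans Q≡n (cong +_ n≡m′c)
  where
  instance
    _ : NonZero q
    _ = prime⇒nonZero q-prime
    _ : NonZero (q ℕ.* q)
    _ = ℕ.m*n≢0 q q
  q∣Q : + q ∣ℤ Q a b
  q∣Q = ℤ∣.∣ᵤ⇒∣ (subst (λ i → q ∣ ∣ i ∣) (sym Q≡mc) (∣-trans q∣m (m∣m*n c)))
  open ℤ∣._∣_ (q-inert a b q∣Q)
    using () renaming (quotient to a′; equality to a≡a′q)
  open ℤ∣._∣_ (q-inert b a (subst (+ q ∣ℤ_) (Q-comm a b) q∣Q))
    using () renaming (quotient to b′; equality to b≡b′q)
  n : ℕ
  n = ∣ Q a′ b′ ∣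
  Q≡n : Q a′ b′ ≡ + n
  Q≡n = sym (ℤ.0≤i⇒+∣i∣≡i (Q-nonneg a′ b′))
  nqq≡mc : n ℕ.* (q ℕ.* q) ≡ m ℕ.* c
  nqq≡mc = ℤ.+-injective (begin
    + (n ℕ.* (q ℕ.* q))      ≡⟨ ℤ.pos-* n (q ℕ.* q) ⟩
    + n * + (q ℕ.* q)        ≡⟨ cong₂ _*_ Q≡n (sym (ℤ.pos-* q q)) ⟨
    Q a′ b′ * (+ q * + q)    ≡⟨ Q-*ʳ a′ b′ (+ q) ⟨
    Q (a′ * + q) (b′ * + q)  ≡⟨ cong₂ Q a≡a′q b≡b′q ⟨
    Q a b                    ≡⟨ Q≡mc ⟩
    + (m ℕ.* c)              ∎)
  q⊥c : Coprime q c
  q⊥c (d∣q , d∣c) = m⊥c (∣-trans d∣q q∣m , d∣c)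
  m′ : ℕ
  m′ = m / (q ℕ.* q)
  m≡m′qq : m ≡ m′ ℕ.* (q ℕ.* q)
  m≡m′qq = sym (m/n*n≡m (coprime-divisor (coprime-* q⊥c q⊥c) (divides n (trans (ℕ.*-comm c m) (sym nqq≡mc)))))
  n≡m′c : n ≡ m′ ℕ.* c
  n≡m′c = ℕ.*-cancelʳ-≡ n (m′ ℕ.* c) (q ℕ.* q) (begin
    n ℕ.* (q ℕ.* q)          ≡⟨ nqq≡mc ⟩
    m ℕ.* c                  ≡⟨ cong (ℕ._* c) m≡m′qq ⟩
    m′ ℕ.* (q ℕ.* q) ℕ.* c   ≡⟨ ℕ.*-assoc m′ (q ℕ.* q) c ⟩
    m′ ℕ.* (q ℕ.* q ℕ.* c)   ≡⟨ cong (m′ ℕ.*_) (ℕ.*-comm (q ℕ.* q) c) ⟩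
    m′ ℕ.* (c ℕ.* (q ℕ.* q)) ≡⟨ ℕ.*-assoc m′ c (q ℕ.* q) ⟨
    m′ ℕ.* c ℕ.* (q ℕ.* q)   ∎)

smaller-Q-multiple : ∀ {m c} → m % 3 ≡ 2 → InertBelow (suc m) → Coprime m c →
                     ∀ a b → Q a b ≡ + (m ℕ.* c) →
                     ∃₂ λ m′ a′ → ∃ λ b′ → m′ < m × m′ % 3 ≡ 2 × m′ ∣ m × Q a′ b′ ≡ + (m′ ℕ.* c)
smaller-Q-multiple {m} m≡2 inert m⊥c a b Q≡mc =
  let q , q-prime , q≡2 , q∣m = prime-factor%3≡2 m m≡2
      q-inert = inert (s≤s (∣⇒≤ {{%3≡2⇒nonZero m≡2}} q∣m)) q-prime q≡2
      m′ , a′ , b′ , m≡m′qq , Q′≡ = Q-divide-out q-prime q-inert q∣m m⊥c a b Q≡mc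
      m′≡2 = trans (sym (%3-*-square m′ q q≡2)) (trans (cong (_% 3) (sym m≡m′qq)) m≡2)
      1<qq = ℕ.<-≤-trans (ℕ.nonTrivial⇒n>1 q {{prime⇒nonTrivial q-prime}})
                         (ℕ.m≤m*n q q {{prime⇒nonZero q-prime}})
      m′<m = subst (m′ <_) (sym m≡m′qq) (ℕ.m<m*n m′ (q ℕ.* q) {{%3≡2⇒nonZero m′≡2}} 1<qq)
  in m′ , a′ , b′ , m′<m , m′≡2 , subst (m′ ∣_) (sym m≡m′qq) (m∣m*n (q ℕ.* q)) , Q′≡

no-Q-multiple : ∀ m → m % 3 ≡ 2 → InertBelow (suc m) → ∀ {c} → Coprime m c → ∀ a b → Q a b ≢ + (m ℕ.* c)
no-Q-multiple = <-rec _ descend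
  where
  descend : ∀ m → (∀ {m′} → m′ < m → m′ % 3 ≡ 2 → InertBelow (suc m′) →
                                      ∀ {c} → Coprime m′ c → ∀ a b → Q a b ≢ + (m′ ℕ.* c)) →
            m % 3 ≡ 2 → InertBelow (suc m) → ∀ {c} → Coprime m c → ∀ a b → Q a b ≢ + (m ℕ.* c)
  descend m rec m≡2 inert m⊥c a b Q≡mc =
    let m′ , a′ , b′ , m′<m , m′≡2 , m′∣m , Q′≡ = smaller-Q-multiple m≡2 inert m⊥c a b Q≡mc
    in rec m′<m m′≡2 (λ q<1+m′ → inert (ℕ.<-trans q<1+m′ (s≤s m′<m)))
           (λ (d∣m′ , d∣c) → m⊥c (∣-trans d∣m′ m′∣m , d∣c)) a′ b′ Q′≡

Qℕ≢small-multiple : ∀ {p} → Prime p → p % 3 ≡ 2 → InertBelow p →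
                    ∀ k → 0 < k → k < p → ∀ x y → Qℕ x y ≢ k ℕ.* p
Qℕ≢small-multiple {p} p-prime p≡2 inert = <-rec _ descend
  where
  descend : ∀ k → (∀ {k′} → k′ < k → 0 < k′ → k′ < p → ∀ x y → Qℕ x y ≢ k′ ℕ.* p) →
            0 < k → k < p → ∀ x y → Qℕ x y ≢ k ℕ.* p
  descend zero _ ()
  descend k@(suc _) rec _ k<p x y Q≡kp with %3-cases k
  ... | inj₁ k≡0 =
    let k≡3[k/3] = cong (ℕ._* p) (sym (m*[n/m]≡n 3∣k))
        x′ , y′ , Q′≡ = Qℕ-multiple-of-3 x y (trans Q≡kp (trans k≡3[k/3] (ℕ.*-assoc 3 (k / 3) p)))
    in rec (m/n<m k 3 (s≤s (s≤s z≤n))) (m≥n⇒m/n>0 (∣⇒≤ 3∣k)) (ℕ.≤-<-trans (m/n≤m k 3) k<p) x′ y′ Q′≡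
    where
    3∣k : 3 ∣ k
    3∣k = m%n≡0⇒n∣m k 3 k≡0
  ... | inj₂ (inj₁ k≡1) = Qℕ%3≢2 x y (trans (cong (_% 3) Q≡kp) (%-*-≡ k p 3 k≡1 p≡2))
  ... | inj₂ (inj₂ k≡2) =
    no-Q-multiple k k≡2 (λ q<1+k → inert (ℕ.<-≤-trans q<1+k k<p)) (Coprime.sym (prime⇒coprime p-prime k<p))
                  (+ x) (+ y) (trans (Q-pos x y) (cong +_ Q≡kp))

∣ℤ-minus-% : ∀ a n .{{_ : NonZero n}} → + n ∣ℤ a - + (a ℤ.% + n)
∣ℤ-minus-% a n = divides (a ℤ./ + n) (begin
  a - + (a ℤ.% + n)                           ≡⟨ cong (_- + (a ℤ.% + n)) (ℤ.a≡a%n+[a/n]*n a (+ n)) ⟩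
  + (a ℤ.% + n) + a ℤ./ + n * + n - + (a ℤ.% + n)  ≡⟨ identity (+ (a ℤ.% + n)) (a ℤ./ + n * + n) ⟩
  a ℤ./ + n * + n                             ∎)
  where
  identity : ∀ r m → r + m - r ≡ m
  identity = solve-∀

-- Reducing −b rather than b modulo p is what keeps Q (r, −s) = r² − r s + s² below p².
Q-reduce-mod : ∀ {p} .{{_ : NonZero p}} a b → ¬ (+ p ∣ℤ a) → + p ∣ℤ Q a b →
               ∃₂ λ x y → 0 < x ℕ.+ y × x ℕ.+ y < p × p ∣ Qℕ x y
Q-reduce-mod {p} a b p∤a p∣Q with Q-pos-neg (a ℤ.% + p) ((- b) ℤ.% + p)
... | x , y , x+y≡r⊔s , Q≡ =
  x , y , subst (0 <_) (sym x+y≡r⊔s) (ℕ.<-≤-trans 0<r (ℕ.m≤m⊔n r s)) ,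
  subst (_< p) (sym x+y≡r⊔s) (ℕ.⊔-pres-<m (ℤ.n%d<d a (+ p)) (ℤ.n%d<d (- b) (+ p))) ,
  ℤ∣.∣⇒∣ᵤ (subst (+ p ∣ℤ_) Q≡ (Q-cong a b (+ r) (- + s) (∣ℤ-minus-% a p) p∣b+s p∣Q))
  where
  r s : ℕ
  r = a ℤ.% + p
  s = (- b) ℤ.% + p
  0<r : 0 < r
  0<r = ℕ.n≢0⇒n>0 λ r≡0 →
    p∤a (subst (+ p ∣ℤ_) (ℤ.+-identityʳ a) (subst (λ r → + p ∣ℤ a - + r) r≡0 (∣ℤ-minus-% a p)))
  p∣b+s : + p ∣ℤ b - (- + s)
  p∣b+s = subst (+ p ∣ℤ_) (identity b (+ s)) (ℤ∣.∣m⇒∣-m (∣ℤ-minus-% (- b) p))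
    where
    identity : ∀ b s → - (- b - s) ≡ b - (- s)
    identity = solve-∀

small-quotient : ∀ x y k {p} → 0 < x ℕ.+ y → x ℕ.+ y < p → Qℕ x y ≡ k ℕ.* p → 0 < k × k < p
small-quotient x y k {p} 0<x+y x+y<p Q≡kp =
  ℕ.*-cancelʳ-< p 0 k (subst (0 <_) Q≡kp (Qℕ-pos x y 0<x+y)) ,
  ℕ.*-cancelʳ-< p k p (subst (_< p ℕ.* p) Q≡kp (ℕ.≤-<-trans (Qℕ≤square x y) (ℕ.*-mono-< x+y<p x+y<p)))

inert-step : ∀ p → InertBelow p → Prime p → p % 3 ≡ 2 → Inert p
inert-step p inert p-prime p≡2 a b p∣Q with + p ∣ℤ? a
... | yes p∣a = p∣a
... | no p∤a =
  let x , y , 0<x+y , x+y<p , p∣Qℕ = Q-reduce-mod a b p∤a p∣Q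
      Q≡kp = sym (m/n*n≡m p∣Qℕ)
      0<k , k<p = small-quotient x y (Qℕ x y / p) 0<x+y x+y<p Q≡kp
  in ⊥-elim (Qℕ≢small-multiple p-prime p≡2 inert (Qℕ x y / p) 0<k k<p x y Q≡kp)
  where
  instance
    _ : NonZero p
    _ = prime⇒nonZero p-prime

inert : ∀ {p} → Prime p → p % 3 ≡ 2 → Inert p
inert {p} = <-rec _ inert-step p

-- The equation X² + Y² + Z² = 3ℓ²

-- Modulo 3 the hypotheses say t ≡ 1 + d, w ≡ −d and q ≡ d², so t w = 8 q reads −d − d² ≡ −d², i.e. d ≡ 0.
factor≡1[mod3] : ∀ t w q d → t ≡ (+ 1 + d) [modℤ 3 ] → (t + w) ≡ (+ 1) [modℤ 3 ] → q ≡ (d * d) [modℤ 3 ] →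
           t * w ≡ + 8 * q → t ≡ (+ 1) [modℤ 3 ]
factor≡1[mod3] t w q d t≡1+d t+w≡1 q≡d² tw≡8q = ℤ∣.∣⇒∣ᵤ (subst (+ 3 ∣ℤ_) (identity t w q d)
  (ℤ∣.∣m∣n⇒∣m-n (ℤ∣.∣m∣n⇒∣m-n (ℤ∣.∣m∣n⇒∣m-n
    (ℤ∣.∣m∣n⇒∣m+n (ℤ∣.∣m⇒∣m*n (+ 1 - d) 3∣A) (ℤ∣.∣m⇒∣m*n t (ℤ∣.∣m∣n⇒∣m-n 3∣S 3∣A)))
    (ℤ∣.∣n⇒∣m*n (+ 8) 3∣C))
    (ℤ∣.∣m⇒∣m*n (d * d) (divides (+ 3) refl)))
    (subst (+ 3 ∣ℤ_) (sym (ℤ.i≡j⇒i-j≡0 tw≡8q)) (divides 0ℤ refl))))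
  where
  3∣A : + 3 ∣ℤ t - (+ 1 + d)
  3∣A = ℤ∣.∣ᵤ⇒∣ {i = t - (+ 1 + d)} t≡1+d
  3∣S : + 3 ∣ℤ t + w - + 1
  3∣S = ℤ∣.∣ᵤ⇒∣ {i = t + w - + 1} t+w≡1
  3∣C : + 3 ∣ℤ q - d * d
  3∣C = ℤ∣.∣ᵤ⇒∣ {i = q - d * d} q≡d²
  identity : ∀ t w q d →
    (t - (+ 1 + d)) * (+ 1 - d) + (t + w - + 1 - (t - (+ 1 + d))) * t - + 8 * (q - d * d) - + 9 * (d * d) - (t * w - + 8 * q)
    ≡ t - + 1
  identity = solve-∀

no-8Q-splitℕ : ∀ {ℓ} → Prime ℓ → ∀ m n α β → m ℕ.+ n ≡ ℓ → + (m ℕ.* n) ≡ + 8 * Q α β →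
               m % 3 ≡ 1 → n % 2 ≡ 1 → ⊥
no-8Q-splitℕ _ zero _ _ _ _ _ () _
no-8Q-splitℕ _ (suc _) zero _ _ _ _ _ ()
no-8Q-splitℕ ℓ-prime m@(suc _) n@(suc _) α β m+n≡ℓ mn≡8Q m≡1 n≡1 =
  no-Q-multiple (2 ℕ.* m) (%-*-≡ 2 m 3 refl m≡1) (λ _ → inert) (coprime-* 2⊥n m⊥n) (α * + 4) (β * + 4) Q≡2mn
  where
  2⊥n : Coprime 2 n
  2⊥n = prime∤⇒coprime prime[2] λ 2∣n → contradiction (trans (sym n≡1) (n∣m⇒m%n≡0 n 2 2∣n)) λ ()
  m<ℓ : m < _
  m<ℓ = subst (m <_) m+n≡ℓ (ℕ.m<m+n m ℕ.z<s)
  m⊥n : Coprime m n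
  m⊥n (d∣m , d∣n) = prime⇒coprime ℓ-prime m<ℓ (subst (_ ∣_) m+n≡ℓ (∣m∣n⇒∣m+n d∣m d∣n) , d∣m)
  -- 16 = 4², so the factor 2 making 2m ≡ 2 (mod 3) is absorbed into the arguments of Q.
  Q≡2mn : Q (α * + 4) (β * + 4) ≡ + (2 ℕ.* m ℕ.* n)
  Q≡2mn = begin
    Q (α * + 4) (β * + 4)   ≡⟨ Q-*ʳ α β (+ 4) ⟩
    Q α β * (+ 4 * + 4)     ≡⟨ identity (Q α β) ⟩
    + 2 * (+ 8 * Q α β)     ≡⟨ cong (+ 2 *_) mn≡8Q ⟨
    + 2 * + (m ℕ.* n)       ≡⟨ ℤ.pos-* 2 (m ℕ.* n) ⟨
    + (2 ℕ.* (m ℕ.* n))     ≡⟨ cong +_ (ℕ.*-assoc 2 m n) ⟨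
    + (2 ℕ.* m ℕ.* n)       ∎
    where
    identity : ∀ q → q * (+ 4 * + 4) ≡ + 2 * (+ 8 * q)
    identity = solve-∀

no-8Q-split : ∀ {ℓ} → Prime ℓ → ∀ t w α β → t + w ≡ + ℓ → t * w ≡ + 8 * Q α β →
              t ≡ (+ 1) [modℤ 3 ] → w ≡ (+ 1) [modℤ 2 ] → ⊥
no-8Q-split ℓ-prime t w α β t+w≡ℓ tw≡8Q t≡1 w≡1
  with nonneg-summands t w (subst (0ℤ ≤_) (sym tw≡8Q) (0≤i*j {+ 8} (+≤+ z≤n) (Q-nonneg α β)))
                           (subst (0ℤ ≤_) (sym t+w≡ℓ) (+≤+ z≤n))
no-8Q-split ℓ-prime .(+ m) .(+ n) α β t+w≡ℓ tw≡8Q t≡1 w≡1 | +≤+ {n = m} _ , +≤+ {n = n} _ =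
  no-8Q-splitℕ ℓ-prime m n α β (ℤ.+-injective t+w≡ℓ) (trans (ℤ.pos-* m n) tw≡8Q)
               (≡1[modℤ]⇒%≡1 m t≡1) (≡1[modℤ]⇒%≡1 n w≡1)

-- c = 1 + 6j, ℓ = c + 12L, and X, Y, Z = c + 4 + 12x, c + 4 + 12y, c + 4 + 12z.
module Split (j L x y z : ℤ) where
  t w α β : ℤ
  t = + 6 * L - + 2 - + 2 * (x + y + z)
  w = + 1 + j * + 6 + + 2 + + 6 * L + + 2 * (x + y + z)
  α = x - y
  β = y - z

  t+w≡ℓ : t + w ≡ + 1 + j * + 6 + L * + 12
  t+w≡ℓ = identity j L x y z
    where
    identity : ∀ j L x y z → + 6 * L - + 2 - + 2 * (x + y + z) + (+ 1 + j * + 6 + + 2 + + 6 * L + + 2 * (x + y + z))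
                             ≡ + 1 + j * + 6 + L * + 12
    identity = solve-∀

  sum-of-squares :
    (+ 1 + j * + 6 + + 4 + x * + 12) * (+ 1 + j * + 6 + + 4 + x * + 12)
      + (+ 1 + j * + 6 + + 4 + y * + 12) * (+ 1 + j * + 6 + + 4 + y * + 12)
      + (+ 1 + j * + 6 + + 4 + z * + 12) * (+ 1 + j * + 6 + + 4 + z * + 12)
      - + 3 * ((+ 1 + j * + 6 + L * + 12) * (+ 1 + j * + 6 + L * + 12))
    ≡ + 12 * (+ 8 * Q α β - t * w)
  sum-of-squares = identity j L x y z
    where
    identity : ∀ j L x y z →
      (+ 1 + j * + 6 + + 4 + x * + 12) * (+ 1 + j * + 6 + + 4 + x * + 12)
        + (+ 1 + j * + 6 + + 4 + y * + 12) * (+ 1 + j * + 6 + + 4 + y * + 12)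
        + (+ 1 + j * + 6 + + 4 + z * + 12) * (+ 1 + j * + 6 + + 4 + z * + 12)
        - + 3 * ((+ 1 + j * + 6 + L * + 12) * (+ 1 + j * + 6 + L * + 12))
      ≡ + 12 * (+ 8 * ((x - y) * (x - y) + (x - y) * (y - z) + (y - z) * (y - z))
                - (+ 6 * L - + 2 - + 2 * (x + y + z)) * (+ 1 + j * + 6 + + 2 + + 6 * L + + 2 * (x + y + z)))
    identity = solve-∀

  t≡1+α-β : t ≡ (+ 1 + (α - β)) [modℤ 3 ]
  t≡1+α-β = ℤ∣.∣⇒∣ᵤ (divides (+ 2 * L - + 1 - x - z) (identity L x y z))
    where
    identity : ∀ L x y z → + 6 * L - + 2 - + 2 * (x + y + z) - (+ 1 + (x - y - (y - z))) ≡ (+ 2 * L - + 1 - x - z) * + 3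
    identity = solve-∀

  t+w≡1 : (t + w) ≡ (+ 1) [modℤ 3 ]
  t+w≡1 = ℤ∣.∣⇒∣ᵤ (divides (+ 2 * j + + 4 * L) (identity j L x y z))
    where
    identity : ∀ j L x y z → + 6 * L - + 2 - + 2 * (x + y + z) + (+ 1 + j * + 6 + + 2 + + 6 * L + + 2 * (x + y + z)) - + 1
                             ≡ (+ 2 * j + + 4 * L) * + 3
    identity = solve-∀

  w≡1 : w ≡ (+ 1) [modℤ 2 ]
  w≡1 = ℤ∣.∣⇒∣ᵤ (divides (+ 3 * j + + 1 + + 3 * L + (x + y + z)) (identity j L x y z))
    where
    identity : ∀ j L x y z → + 1 + j * + 6 + + 2 + + 6 * L + + 2 * (x + y + z) - + 1
                             ≡ (+ 3 * j + + 1 + + 3 * L + (x + y + z)) * + 2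
    identity = solve-∀

no-solution : ∀ {ℓ} → Prime ℓ → ∀ c → c ≡ (+ 1) [modℤ 6 ] → (+ ℓ) ≡ c [modℤ 12 ] → ∀ X Y Z →
              X ≡ (c + + 4) [modℤ 12 ] → Y ≡ (c + + 4) [modℤ 12 ] → Z ≡ (c + + 4) [modℤ 12 ] →
              ¬ (X * X + Y * Y + Z * Z ≡ + 3 * (+ ℓ * + ℓ))
no-solution {ℓ} ℓ-prime c c≡1 ℓ≡c X Y Z X≡ Y≡ Z≡ sum≡
  with j , refl ← modℤ-witness c (+ 1) c≡1
     | L , ℓ≡ ← modℤ-witness (+ ℓ) c ℓ≡c
     | x , refl ← modℤ-witness X (c + + 4) X≡
     | y , refl ← modℤ-witness Y (c + + 4) Y≡
     | z , refl ← modℤ-witness Z (c + + 4) Z≡ =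
  no-8Q-split ℓ-prime t w α β (trans t+w≡ℓ (sym ℓ≡)) tw≡8Q
              (factor≡1[mod3] t w (Q α β) (α - β) t≡1+α-β t+w≡1 (Q-mod3 α β) tw≡8Q) w≡1
  where
  open Split j L x y z
  tw≡8Q : t * w ≡ + 8 * Q α β
  tw≡8Q = sym (ℤ.i-j≡0⇒i≡j _ _ (ℤ.*-cancelˡ-≡ (+ 12) _ 0ℤ
            (trans (sym sum-of-squares) (ℤ.i≡j⇒i-j≡0 (trans sum≡ (cong (λ l → + 3 * (l * l)) ℓ≡))))))

theorem5p2 : ((ℓ : ℕ) → Prime ℓ → (+ ℓ) ≡ (+ 1) [modℤ 12 ] →
               (X Y Z : ℤ) → X ≡ (+ 5) [modℤ 12 ] → Y ≡ (+ 5) [modℤ 12 ] → Z ≡ (+ 5) [modℤ 12 ] →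
               ¬ (X * X + Y * Y + Z * Z ≡ (+ 3) * ((+ ℓ) * (+ ℓ))))
             × ((ℓ : ℕ) → Prime ℓ → (+ ℓ) ≡ (+ 7) [modℤ 12 ] →
               (X Y Z : ℤ) → X ≡ (+ 1) [modℤ 12 ] → Y ≡ (+ 1) [modℤ 12 ] → Z ≡ (+ 1) [modℤ 12 ] →
               ¬ (X * X + Y * Y + Z * Z ≡ (+ 3) * ((+ ℓ) * (+ ℓ))))
theorem5p2 =
  (λ ℓ ℓ-prime ℓ≡1 → no-solution ℓ-prime (+ 1) (divides 0 refl) ℓ≡1) ,
  (λ ℓ ℓ-prime ℓ≡7 X Y Z X≡1 Y≡1 Z≡1 sum≡ →
    no-solution ℓ-prime (+ 7) ∣-refl ℓ≡7 (- X) (- Y) (- Z)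
                (modℤ-neg X (+ 1) X≡1) (modℤ-neg Y (+ 1) Y≡1) (modℤ-neg Z (+ 1) Z≡1)
                (trans (neg-squares X Y Z) sum≡))
  where
  neg-squares : ∀ X Y Z → (- X) * (- X) + (- Y) * (- Y) + (- Z) * (- Z) ≡ X * X + Y * Y + Z * Z
  neg-squares = solve-∀
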